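{- Let $n$ and $k$ be integers with $2\le k\le \frac{1+\sqrt{8n-7}}{2}$. If $G$ is an $(n-k)$-regular graph on $n$ vertices that is $(a,k-2)$-distance antimagic, then there exists a non-regular graph on $n+1$ vertices that is $(a',k-2)$-distance antimagic, where $a'=a+n+1$.
   Context: For integers $a$ and $d\ge 0$, an $(a,d)$-distance antimagic labeling of a graph $G$ on $N$ vertices is a bijection $f:V(G)\to\{1,\dots,N\}$ such that the set of vertex weights $\{\sum_{v\in N_G(u)}f(v): u\in V(G)\}$ equals $\{a,a+d,\dots,a+(N-1)d\}$; $G$ is $(a,d)$-distance antimagic if it admits one (for $d=0$ this is a distance magic labeling). -}

module Defs where

open import Data.Nat using (ℕ; zero; suc; _+_; _*_; _∸_)
open import Data.Bool using (Bool; true; false; if_then_else_)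
open import Data.Fin using (Fin; toℕ)
import Data.Fin
open import Data.Integer using (ℤ; +_) renaming (_+_ to _+ℤ_; _*_ to _*ℤ_)
open import Data.Product using (Σ; ∃; _×_)
open import Data.Nat using (_<_)
open import Relation.Binary.PropositionalEquality using (_≡_; _≢_)
open import Function.Bundles using (Bijection)
open import Relation.Binary.PropositionalEquality using (setoid)
open import Relation.Nullary using (¬_)

sumFin : (N : ℕ) → (Fin N → ℕ) → ℕ
sumFin zero    g = 0
sumFin (suc N) g = g Data.Fin.zero + sumFin N (λ i → g (Data.Fin.suc i))


record Graph (N : ℕ) : Set where
  field
    adj   : Fin N → Fin N → Bool
    sym   : ∀ u v → adj u v ≡ adj v u
    loopless : ∀ u → adj u u ≡ false
open Graph public

degree : ∀ {N} → Graph N → Fin N → ℕ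
degree {N} G u = sumFin N (λ v → if adj G u v then 1 else 0)

Regular : ∀ {N} → Graph N → ℕ → Set
Regular G r = ∀ u → degree G u ≡ r

NonRegular : ∀ {N} → Graph N → Set
NonRegular G = ∃ λ u → ∃ λ v → degree G u ≢ degree G v

-- A labeling is a bijection f : V → {1..N}; we encode label(v) = toℕ (f v) + 1
-- with f : Fin N → Fin N a bijection.
Labeling : ℕ → Set
Labeling N = Bijection (setoid (Fin N)) (setoid (Fin N))

label : ∀ {N} → Labeling N → Fin N → ℕ
label f v = suc (toℕ (Bijection.to f v))

weight : ∀ {N} → Graph N → Labeling N → Fin N → ℕ
weight {N} G f u = sumFin N (λ v → if adj G u v then label f v else 0)

-- the set of weights equals {a, a+d, ..., a+(N-1)d}
IsDistanceAntimagicLabeling : ∀ {N} → Graph N → ℤ → ℕ → Labeling N → Set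
IsDistanceAntimagicLabeling {N} G a d f =
  (∀ u → ∃ λ (i : ℕ) → i < N × + weight G f u ≡ a +ℤ (+ i) *ℤ (+ d))
  × (∀ (i : ℕ) → i < N → ∃ λ u → + weight G f u ≡ a +ℤ (+ i) *ℤ (+ d))

DistanceAntimagic : ∀ {N} → Graph N → ℤ → ℕ → Set
DistanceAntimagic G a d = ∃ λ f → IsDistanceAntimagicLabeling G a d f

module Submission where

-- Add an apex adjacent to all n vertices and give it the new label n + 1. Every old weight grows
-- by n + 1, so the progression a, …, a + (n - 1)d moves to a′ = a + n + 1, …, and the apex, of
-- degree n, is the only vertex not of degree n - k + 1. The apex weight is the label sum
-- n(n + 1)/2, and double counting the weights of the (n - k)-regular graph G gives
-- (n - k)·n(n + 1)/2 = n a + d·n(n - 1)/2; with d = k - 2 this says precisely that the apex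
-- weight is the missing term a′ + n d.

open import Defs hiding (sym)
import Algebra.Properties.CommutativeMonoid.Sum as CommutativeMonoidSum
open import Data.Bool using (Bool; true; false; if_then_else_)
open import Data.Fin using (Fin; zero; suc; toℕ; fromℕ; fromℕ<; punchIn)
open import Data.Fin.Permutation using (Permutation′; permutation; insert; insert-punchIn; _⟨$⟩ʳ_)
import Data.Fin.Properties as Fin
open import Data.Integer using (ℤ; +_) renaming (_+_ to _+ℤ_; _*_ to _*ℤ_)
import Data.Integer.Properties as Int
import Data.Integer.Tactic.RingSolver as IntSolver
open import Data.Nat using (ℕ; zero; suc; _+_; _*_; _∸_; _≤_; _<_; _≤?_; NonZero; z<s; s≤s⁻¹)
open import Data.Nat.Properties
open import Data.Nat.Tactic.RingSolver using (solve-∀)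
open import Data.Product using (∃; _×_; _,_; proj₁; proj₂)
open import Function using (_∘_)
open import Function.Properties.Bijection using (⤖⇒↔)
open import Function.Properties.Inverse using (↔⇒⤖)
open import Relation.Binary.PropositionalEquality
open import Relation.Nullary using (yes; no; contradiction)
open import Algebra.Properties.AbelianGroup Int.+-0-abelianGroup using (∙-cancelˡ; ∙-cancelʳ)
open import Algebra.Properties.CommutativeSemigroup +-commutativeSemigroup using (interchange)

sumFin-cong : ∀ n {g h : Fin n → ℕ} → (∀ i → g i ≡ h i) → sumFin n g ≡ sumFin n h
sumFin-cong zero    g≗h = refl
sumFin-cong (suc n) g≗h = cong₂ _+_ (g≗h zero) (sumFin-cong n (g≗h ∘ suc))

sumFin-+ : ∀ n (g h : Fin n → ℕ) → sumFin n (λ i → g i + h i) ≡ sumFin n g + sumFin n h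
sumFin-+ zero    g h = refl
sumFin-+ (suc n) g h = trans (cong (_+_ (g zero + h zero)) (sumFin-+ n (g ∘ suc) (h ∘ suc)))
                             (interchange (g zero) (h zero) _ _)

sumFin-const : ∀ n c → sumFin n (λ _ → c) ≡ n * c
sumFin-const zero    c = refl
sumFin-const (suc n) c = cong (_+_ c) (sumFin-const n c)

sumFin-suc : ∀ n (g : Fin n → ℕ) → sumFin n (λ i → suc (g i)) ≡ n + sumFin n g
sumFin-suc n g = trans (sumFin-+ n (λ _ → 1) g) (cong (_+ sumFin n g) (trans (sumFin-const n 1) (*-identityʳ n)))

sumFin-*ˡ : ∀ n c (g : Fin n → ℕ) → sumFin n (λ i → c * g i) ≡ c * sumFin n g
sumFin-*ˡ zero    c g = sym (*-zeroʳ c)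
sumFin-*ˡ (suc n) c g = trans (cong (_+_ (c * g zero)) (sumFin-*ˡ n c (g ∘ suc)))
                              (sym (*-distribˡ-+ c (g zero) _))

sumFin-comm : ∀ m n (h : Fin m → Fin n → ℕ) →
  sumFin m (λ i → sumFin n (h i)) ≡ sumFin n (λ j → sumFin m (λ i → h i j))
sumFin-comm zero    n h = sym (trans (sumFin-const n 0) (*-zeroʳ n))
sumFin-comm (suc m) n h = trans (cong (_+_ (sumFin n (h zero))) (sumFin-comm m n (h ∘ suc)))
                                (sym (sumFin-+ n (h zero) _))

module ℕSum = CommutativeMonoidSum +-0-commutativeMonoid

sumFin≡sum : ∀ n (g : Fin n → ℕ) → sumFin n g ≡ ℕSum.sum g
sumFin≡sum zero    g = refl
sumFin≡sum (suc n) g = cong (_+_ (g zero)) (sumFin≡sum n (g ∘ suc))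

sumFin-permute : ∀ n (π : Permutation′ n) (g : Fin n → ℕ) → sumFin n (g ∘ (π ⟨$⟩ʳ_)) ≡ sumFin n g
sumFin-permute n π g = begin
  sumFin n (g ∘ (π ⟨$⟩ʳ_)) ≡⟨ sumFin≡sum n _ ⟩
  ℕSum.sum (g ∘ (π ⟨$⟩ʳ_)) ≡⟨ sym (ℕSum.sum-permute g π) ⟩
  ℕSum.sum g               ≡⟨ sym (sumFin≡sum n g) ⟩
  sumFin n g               ∎
  where open ≡-Reasoning

2*sumFin-toℕ+n≡n*n : ∀ n → 2 * sumFin n toℕ + n ≡ n * n
2*sumFin-toℕ+n≡n*n zero    = refl
2*sumFin-toℕ+n≡n*n (suc n) = begin
  2 * sumFin n (suc ∘ toℕ) + suc n ≡⟨ cong (λ s → 2 * s + suc n) (sumFin-suc n toℕ) ⟩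
  2 * (n + S) + suc n              ≡⟨ regroup n S ⟩
  (2 * S + n) + 2 * n + 1          ≡⟨ cong (λ x → x + 2 * n + 1) (2*sumFin-toℕ+n≡n*n n) ⟩
  n * n + 2 * n + 1                ≡⟨ square-suc n ⟩
  suc n * suc n                    ∎
  where
  open ≡-Reasoning
  S : ℕ
  S = sumFin n toℕ
  regroup : ∀ n s → 2 * (n + s) + suc n ≡ (2 * s + n) + 2 * n + 1
  regroup = solve-∀
  square-suc : ∀ n → n * n + 2 * n + 1 ≡ suc n * suc n
  square-suc = solve-∀

label-sum : ∀ {n} (f : Labeling n) → sumFin n (label f) ≡ n + sumFin n toℕ
label-sum {n} f = trans (sumFin-permute n (⤖⇒↔ f) (suc ∘ toℕ)) (sumFin-suc n toℕ)

if-then-else-0≡* : ∀ b x → (if b then x else 0) ≡ x * (if b then 1 else 0)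
if-then-else-0≡* true  x = sym (*-identityʳ x)
if-then-else-0≡* false x = sym (*-zeroʳ x)

sumFin-weight : ∀ {n} (G : Graph n) (f : Labeling n) →
  sumFin n (weight G f) ≡ sumFin n (λ v → label f v * degree G v)
sumFin-weight {n} G f = begin
  sumFin n (λ u → sumFin n (λ v → if adj G u v then label f v else 0))
    ≡⟨ sumFin-cong n (λ u → sumFin-cong n (λ v → edge-term u v)) ⟩
  sumFin n (λ u → sumFin n (λ v → label f v * (if adj G v u then 1 else 0)))
    ≡⟨ sumFin-comm n n _ ⟩
  sumFin n (λ v → sumFin n (λ u → label f v * (if adj G v u then 1 else 0)))
    ≡⟨ sumFin-cong n (λ v → sumFin-*ˡ n (label f v) _) ⟩
  sumFin n (λ v → label f v * degree G v) ∎
  where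
  open ≡-Reasoning
  edge-term : ∀ u v → (if adj G u v then label f v else 0) ≡ label f v * (if adj G v u then 1 else 0)
  edge-term u v rewrite Graph.sym G u v = if-then-else-0≡* (adj G v u) (label f v)

sumFin-weight-regular : ∀ {n} (G : Graph n) (f : Labeling n) {r} → Regular G r →
  sumFin n (weight G f) ≡ r * sumFin n (label f)
sumFin-weight-regular {n} G f {r} regular = begin
  sumFin n (weight G f)                   ≡⟨ sumFin-weight G f ⟩
  sumFin n (λ v → label f v * degree G v) ≡⟨ sumFin-cong n (λ v → trans (cong (_*_ (label f v)) (regular v)) (*-comm (label f v) r)) ⟩
  sumFin n (λ v → r * label f v)          ≡⟨ sumFin-*ˡ n r (label f) ⟩
  r * sumFin n (label f)                  ∎
  where open ≡-Reasoning

sumFin-affine : ∀ n (w c : Fin n → ℕ) (a d : ℤ) → (∀ u → + w u ≡ a +ℤ + c u *ℤ d) →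
  + sumFin n w ≡ + n *ℤ a +ℤ + sumFin n c *ℤ d
sumFin-affine zero    w c a d w≡ = refl
sumFin-affine (suc n) w c a d w≡ = begin
  + (w zero + sumFin n (w ∘ suc))                  ≡⟨ Int.pos-+ (w zero) _ ⟩
  + w zero +ℤ + sumFin n (w ∘ suc)                 ≡⟨ cong₂ _+ℤ_ (w≡ zero) (sumFin-affine n (w ∘ suc) (c ∘ suc) a d (w≡ ∘ suc)) ⟩
  (a +ℤ + c zero *ℤ d) +ℤ (+ n *ℤ a +ℤ + C *ℤ d)   ≡⟨ regroup a d (+ c zero) (+ n) (+ C) ⟩
  (+ 1 +ℤ + n) *ℤ a +ℤ (+ c zero +ℤ + C) *ℤ d     ≡⟨ sym (cong₂ (λ x y → x *ℤ a +ℤ y *ℤ d) (Int.pos-+ 1 n) (Int.pos-+ (c zero) C)) ⟩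
  + suc n *ℤ a +ℤ + (c zero + C) *ℤ d             ∎
  where
  open ≡-Reasoning
  C : ℕ
  C = sumFin n (c ∘ suc)
  regroup : ∀ a d x n C → (a +ℤ x *ℤ d) +ℤ (n *ℤ a +ℤ C *ℤ d) ≡ (+ 1 +ℤ n) *ℤ a +ℤ (x +ℤ C) *ℤ d
  regroup = IntSolver.solve-∀

progression-injective : ∀ (a : ℤ) d {i j} → a +ℤ + i *ℤ + suc d ≡ a +ℤ + j *ℤ + suc d → i ≡ j
progression-injective a d eq = Int.+-injective (Int.*-cancelʳ-≡ _ _ (+ suc d) (∙-cancelˡ a _ _ eq))

Fin-strictlyInverseˡ⇒strictlyInverseʳ : ∀ {n} (f g : Fin n → Fin n) →
  (∀ i → f (g i) ≡ i) → ∀ j → g (f j) ≡ j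
-- Pigeonhole on j, g 0, …, g (n - 1): g is injective, so j = g i for some i.
Fin-strictlyInverseˡ⇒strictlyInverseʳ {n} f g f∘g≗id j
  with Fin.pigeonhole (n<1+n n) (λ { zero → j ; (suc i) → g i })
... | zero  , suc i , _   , j≡gi  =
  trans (cong (g ∘ f) j≡gi) (trans (cong g (f∘g≗id i)) (sym j≡gi))
... | suc i , suc k , i<k , gi≡gk =
  contradiction (trans (sym (f∘g≗id i)) (trans (cong f gi≡gk) (f∘g≗id k))) (Fin.<⇒≢ i<k ∘ cong suc)

sumFin-weight-antimagic : ∀ {n} (G : Graph n) (a : ℤ) d (f : Labeling n) → IsDistanceAntimagicLabeling G a d f →
  + sumFin n (weight G f) ≡ + n *ℤ a +ℤ + sumFin n toℕ *ℤ + d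
-- For d = 0 the index of a vertex is not determined by its weight, but it is multiplied by 0.
sumFin-weight-antimagic {n} G a zero f (indexOf , _) = begin
  + sumFin n (weight G f)              ≡⟨ sumFin-affine n (weight G f) index a (+ 0) (proj₂ ∘ proj₂ ∘ indexOf) ⟩
  + n *ℤ a +ℤ + sumFin n index *ℤ + 0  ≡⟨ cong (_+ℤ_ (+ n *ℤ a)) (trans (Int.*-zeroʳ (+ sumFin n index)) (sym (Int.*-zeroʳ (+ sumFin n toℕ)))) ⟩
  + n *ℤ a +ℤ + sumFin n toℕ *ℤ + 0    ∎
  where
  open ≡-Reasoning
  index : Fin n → ℕ
  index = proj₁ ∘ indexOf
sumFin-weight-antimagic {n} G a (suc d) f (indexOf , vertexOf) = begin
  + sumFin n (weight G f)                          ≡⟨ sumFin-affine n (weight G f) (toℕ ∘ rank) a (+ suc d) weight-rank ⟩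
  + n *ℤ a +ℤ + sumFin n (toℕ ∘ rank) *ℤ + suc d   ≡⟨ cong (λ s → + n *ℤ a +ℤ + s *ℤ + suc d) (sumFin-permute n π toℕ) ⟩
  + n *ℤ a +ℤ + sumFin n toℕ *ℤ + suc d            ∎
  where
  open ≡-Reasoning
  rank : Fin n → Fin n
  rank u = fromℕ< (proj₁ (proj₂ (indexOf u)))
  weight-rank : ∀ u → + weight G f u ≡ a +ℤ + toℕ (rank u) *ℤ + suc d
  weight-rank u rewrite Fin.toℕ-fromℕ< (proj₁ (proj₂ (indexOf u))) = proj₂ (proj₂ (indexOf u))
  vertex : Fin n → Fin n
  vertex i = proj₁ (vertexOf (toℕ i) (Fin.toℕ<n i))
  rank-vertex : ∀ i → rank (vertex i) ≡ i
  rank-vertex i = Fin.toℕ-injective (progression-injective a d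
    (trans (sym (weight-rank (vertex i))) (proj₂ (vertexOf (toℕ i) (Fin.toℕ<n i)))))
  π : Permutation′ n
  π = permutation rank vertex rank-vertex (Fin-strictlyInverseˡ⇒strictlyInverseʳ rank vertex rank-vertex)

cone : ∀ {n} → Graph n → Graph (suc n)
cone {n} G = record { adj = coneAdj ; sym = coneAdj-sym ; loopless = coneAdj-loopless }
  where
  coneAdj : Fin (suc n) → Fin (suc n) → Bool
  coneAdj zero    zero    = false
  coneAdj zero    (suc _) = true
  coneAdj (suc _) zero    = true
  coneAdj (suc u) (suc v) = adj G u v
  coneAdj-sym : ∀ u v → coneAdj u v ≡ coneAdj v u
  coneAdj-sym zero    zero    = refl
  coneAdj-sym zero    (suc _) = refl
  coneAdj-sym (suc _) zero    = refl
  coneAdj-sym (suc u) (suc v) = Graph.sym G u v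
  coneAdj-loopless : ∀ u → coneAdj u u ≡ false
  coneAdj-loopless zero    = refl
  coneAdj-loopless (suc u) = loopless G u

-- The apex 0 gets label n + 1; the old labels are kept, punchIn (fromℕ n) being the inclusion.
coneLabeling : ∀ {n} → Labeling n → Labeling (suc n)
coneLabeling {n} f = ↔⇒⤖ (insert zero (fromℕ n) (⤖⇒↔ f))

toℕ-punchIn-fromℕ : ∀ {n} (j : Fin n) → toℕ (punchIn (fromℕ n) j) ≡ toℕ j
toℕ-punchIn-fromℕ {suc n} zero    = refl
toℕ-punchIn-fromℕ {suc n} (suc j) = cong suc (toℕ-punchIn-fromℕ j)

label-coneLabeling-zero : ∀ {n} (f : Labeling n) → label (coneLabeling f) zero ≡ suc n
label-coneLabeling-zero {n} f = cong suc (Fin.toℕ-fromℕ n)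

label-coneLabeling-suc : ∀ {n} (f : Labeling n) v → label (coneLabeling f) (suc v) ≡ label f v
label-coneLabeling-suc {n} f v = cong suc (begin
  toℕ (insert zero (fromℕ n) (⤖⇒↔ f) ⟨$⟩ʳ suc v) ≡⟨ cong toℕ (insert-punchIn zero (fromℕ n) (⤖⇒↔ f) v) ⟩
  toℕ (punchIn (fromℕ n) (⤖⇒↔ f ⟨$⟩ʳ v))         ≡⟨ toℕ-punchIn-fromℕ _ ⟩
  toℕ (⤖⇒↔ f ⟨$⟩ʳ v)                              ∎)
  where open ≡-Reasoning

degree-cone-zero : ∀ {n} (G : Graph n) → degree (cone G) zero ≡ n
degree-cone-zero {n} G = trans (sumFin-const n 1) (*-identityʳ n)

weight-cone-zero : ∀ {n} (G : Graph n) (f : Labeling n) →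
  weight (cone G) (coneLabeling f) zero ≡ sumFin n (label f)
weight-cone-zero {n} G f = sumFin-cong n (label-coneLabeling-suc f)

weight-cone-suc : ∀ {n} (G : Graph n) (f : Labeling n) u →
  weight (cone G) (coneLabeling f) (suc u) ≡ suc n + weight G f u
weight-cone-suc {n} G f u = cong₂ _+_ (label-coneLabeling-zero f)
  (sumFin-cong n (λ v → cong (λ x → if adj G u v then x else 0) (label-coneLabeling-suc f v)))

cone-nonRegular : ∀ {n} (G : Graph (suc n)) {r} → Regular G r → r ≢ n → NonRegular (cone G)
cone-nonRegular G regular r≢n = zero , suc zero , λ degrees≡ →
  r≢n (sym (suc-injective (trans (sym (degree-cone-zero G)) (trans degrees≡ (cong suc (regular zero))))))

cone-distanceAntimagic : ∀ {n} (G : Graph n) (a : ℤ) d (f : Labeling n) → IsDistanceAntimagicLabeling G a d f →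
  + sumFin n (label f) ≡ a +ℤ + (n + 1) +ℤ + n *ℤ + d →
  IsDistanceAntimagicLabeling (cone G) (a +ℤ + (n + 1)) d (coneLabeling f)
cone-distanceAntimagic {n} G a d f (indexOf , vertexOf) labelSum≡ = indexOfᶜ , vertexOfᶜ
  where
  a′ : ℤ
  a′ = a +ℤ + (n + 1)
  w : Fin (suc n) → ℕ
  w = weight (cone G) (coneLabeling f)
  w-zero : + w zero ≡ a′ +ℤ + n *ℤ + d
  w-zero = trans (cong +_ (weight-cone-zero G f)) labelSum≡
  w-suc : ∀ {u i} → + weight G f u ≡ a +ℤ + i *ℤ + d → + w (suc u) ≡ a′ +ℤ + i *ℤ + d
  w-suc {u} {i} eq = begin
    + w (suc u)                        ≡⟨ cong +_ (trans (weight-cone-suc G f u) (cong (_+ weight G f u) (+-comm 1 n))) ⟩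
    + (n + 1 + weight G f u)            ≡⟨ Int.pos-+ (n + 1) _ ⟩
    + (n + 1) +ℤ + weight G f u         ≡⟨ cong (_+ℤ_ (+ (n + 1))) eq ⟩
    + (n + 1) +ℤ (a +ℤ + i *ℤ + d)      ≡⟨ regroup (+ (n + 1)) a (+ i *ℤ + d) ⟩
    a′ +ℤ + i *ℤ + d                    ∎
    where
    open ≡-Reasoning
    regroup : ∀ x a y → x +ℤ (a +ℤ y) ≡ a +ℤ x +ℤ y
    regroup = IntSolver.solve-∀
  indexOfᶜ : ∀ u → ∃ λ i → i < suc n × + w u ≡ a′ +ℤ + i *ℤ + d
  indexOfᶜ zero    = n , n<1+n n , w-zero
  indexOfᶜ (suc u) with indexOf u
  ... | i , i<n , eq = i , m<n⇒m<1+n i<n , w-suc {i = i} eq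
  vertexOfᶜ : ∀ i → i < suc n → ∃ λ u → + w u ≡ a′ +ℤ + i *ℤ + d
  vertexOfᶜ i i<1+n with i ≟ n
  ... | yes refl = zero , w-zero
  ... | no  i≢n  with vertexOf i (≤∧≢⇒< (s≤s⁻¹ i<1+n) i≢n)
  ...   | u , eq = suc u , w-suc {i = i} eq

apex-identity : ∀ n e d S → 2 * S + n ≡ n * n → e + (d + 2) ≡ n →
  n * (n + S) + S * d ≡ e * (n + S) + n * ((n + 1) + n * d)
apex-identity n e d S gauss e+d+2≡n = begin
  n * (n + S) + S * d                               ≡⟨ cong (λ x → x * (n + S) + S * d) (sym e+d+2≡n) ⟩
  (e + (d + 2)) * (n + S) + S * d                   ≡⟨ expand e d n S ⟩
  e * (n + S) + (2 * S + n) + n + (2 * S + n) * d   ≡⟨ cong (λ x → e * (n + S) + x + n + x * d) gauss ⟩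
  e * (n + S) + n * n + n + n * n * d               ≡⟨ factor e d n S ⟩
  e * (n + S) + n * ((n + 1) + n * d)               ∎
  where
  open ≡-Reasoning
  expand : ∀ e d n S → (e + (d + 2)) * (n + S) + S * d ≡ e * (n + S) + (2 * S + n) + n + (2 * S + n) * d
  expand = solve-∀
  factor : ∀ e d n S → e * (n + S) + n * n + n + n * n * d ≡ e * (n + S) + n * ((n + 1) + n * d)
  factor = solve-∀

apex-weight : ∀ (a : ℤ) n e d S .{{_ : NonZero n}} → 2 * S + n ≡ n * n → e + (d + 2) ≡ n →
  + n *ℤ a +ℤ + S *ℤ + d ≡ + (e * (n + S)) → + (n + S) ≡ a +ℤ + (n + 1) +ℤ + n *ℤ + d
apex-weight a n e d S gauss e+d+2≡n weightSum =
  Int.*-cancelˡ-≡ (+ n) _ _ (∙-cancelʳ (+ S *ℤ + d) _ _ (begin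
    + n *ℤ + (n + S) +ℤ + S *ℤ + d                                ≡⟨ cong₂ _+ℤ_ (sym (Int.pos-* n _)) (sym (Int.pos-* S d)) ⟩
    + (n * (n + S)) +ℤ + (S * d)                                   ≡⟨ sym (Int.pos-+ (n * (n + S)) (S * d)) ⟩
    + (n * (n + S) + S * d)                                        ≡⟨ cong +_ (apex-identity n e d S gauss e+d+2≡n) ⟩
    + (e * (n + S) + n * (n + 1 + n * d))                          ≡⟨ Int.pos-+ (e * (n + S)) _ ⟩
    + (e * (n + S)) +ℤ + (n * (n + 1 + n * d))                     ≡⟨ cong₂ _+ℤ_ (sym weightSum) cast ⟩
    (+ n *ℤ a +ℤ + S *ℤ + d) +ℤ + n *ℤ (+ (n + 1) +ℤ + n *ℤ + d)  ≡⟨ regroup (+ n) a (+ S *ℤ + d) (+ (n + 1)) (+ d) ⟩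
    + n *ℤ (a +ℤ + (n + 1) +ℤ + n *ℤ + d) +ℤ + S *ℤ + d            ∎))
  where
  open ≡-Reasoning
  cast : + (n * (n + 1 + n * d)) ≡ + n *ℤ (+ (n + 1) +ℤ + n *ℤ + d)
  cast = trans (Int.pos-* n _) (cong (_*ℤ_ (+ n)) (trans (Int.pos-+ (n + 1) _) (cong (_+ℤ_ (+ (n + 1))) (Int.pos-* n d))))
  regroup : ∀ x a y z d → (x *ℤ a +ℤ y) +ℤ x *ℤ (z +ℤ x *ℤ d) ≡ x *ℤ (a +ℤ z +ℤ x *ℤ d) +ℤ y
  regroup = IntSolver.solve-∀

[2k∸1]²≤8n∸7⇒k≤n : ∀ m k → (2 * k ∸ 1) * (2 * k ∸ 1) ≤ 8 * suc m ∸ 7 → k ≤ suc m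
[2k∸1]²≤8n∸7⇒k≤n m k bound with k ≤? suc m
... | yes k≤n = k≤n
... | no  k≰n = contradiction bound (<⇒≱ (begin-strict
  8 * suc m ∸ 7                          ≤⟨ m∸n≤m (8 * suc m) 7 ⟩
  8 * suc m                              <⟨ m<m+n (8 * suc m) z<s ⟩
  8 * suc m + suc (4 * m * m + 4 * m)    ≡⟨ square m ⟩
  (2 * m + 3) * (2 * m + 3)              ≤⟨ *-mono-≤ 2m+3≤2k∸1 2m+3≤2k∸1 ⟩
  (2 * k ∸ 1) * (2 * k ∸ 1)              ∎))
  where
  open ≤-Reasoning
  square : ∀ m → 8 * suc m + suc (4 * m * m + 4 * m) ≡ (2 * m + 3) * (2 * m + 3)
  square = solve-∀
  double : ∀ m → 2 * (2 + m) ≡ suc (2 * m + 3)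
  double = solve-∀
  2m+3≤2k∸1 : 2 * m + 3 ≤ 2 * k ∸ 1
  2m+3≤2k∸1 = begin
    2 * m + 3        ≡⟨ sym (cong (_∸ 1) (double m)) ⟩
    2 * (2 + m) ∸ 1  ≤⟨ ∸-monoˡ-≤ 1 (*-monoʳ-≤ 2 (≰⇒> k≰n)) ⟩
    2 * k ∸ 1        ∎

1+m∸k≢m : ∀ m k → 2 ≤ k → k ≤ suc m → suc m ∸ k ≢ m
1+m∸k≢m m k 2≤k k≤1+m eq = <⇒≢ 2≤k (sym (+-cancelˡ-≡ m k 1 (begin
  m + k            ≡⟨ cong (_+ k) (sym eq) ⟩
  suc m ∸ k + k    ≡⟨ m∸n+n≡m k≤1+m ⟩
  suc m            ≡⟨ +-comm 1 m ⟩
  m + 1            ∎)))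
  where open ≡-Reasoning

theorem4p5 : (n k : ℕ) → 2 ≤ k → 1 ≤ n →
    (2 * k ∸ 1) * (2 * k ∸ 1) ≤ 8 * n ∸ 7 →
    (G : Graph n) → Regular G (n ∸ k) → (a : ℤ) → DistanceAntimagic G a (k ∸ 2) →
    ∃ λ (H : Graph (suc n)) → NonRegular H × DistanceAntimagic H (a +ℤ + (n + 1)) (k ∸ 2)
theorem4p5 zero    k 2≤k ()
theorem4p5 (suc m) k 2≤k _ bound G regular a (f , antimagic) =
  cone G , cone-nonRegular G regular (1+m∸k≢m m k 2≤k k≤n) ,
  coneLabeling f , cone-distanceAntimagic G a d f antimagic apex
  where
  n d S : ℕ
  n = suc m
  d = k ∸ 2
  S = sumFin n toℕ
  k≤n : k ≤ n
  k≤n = [2k∸1]²≤8n∸7⇒k≤n m k bound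
  e+d+2≡n : n ∸ k + (d + 2) ≡ n
  e+d+2≡n = trans (cong (_+_ (n ∸ k)) (m∸n+n≡m 2≤k)) (m∸n+n≡m k≤n)
  weightSum : + n *ℤ a +ℤ + S *ℤ + d ≡ + ((n ∸ k) * (n + S))
  weightSum = trans (sym (sumFin-weight-antimagic G a d f antimagic))
                    (cong +_ (trans (sumFin-weight-regular G f regular) (cong (_*_ (n ∸ k)) (label-sum f))))
  apex : + sumFin n (label f) ≡ a +ℤ + (n + 1) +ℤ + n *ℤ + d
  apex = trans (cong +_ (label-sum f)) (apex-weight a n (n ∸ k) d S (2*sumFin-toℕ+n≡n*n n) e+d+2≡n weightSum)
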